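{- Let $(A,R)$ be an associative unital Rota–Baxter algebra of weight $1$ over a field $\mathbb{K}$ of characteristic zero, and set $\tilde R:=-\mathrm{id}_A-R$. Extend $R,\tilde R$ $t$-linearly to $A[[t]]$. Fix $a\in A$ and let $x,y\in A[[t]]$ be the solutions of $x=1+tR(xa)$ and $y=1+t\tilde R(ay)$. Then $x$ and $y$ are invertible in $A[[t]]$, and their inverses satisfy $$x^{ -1}=1-tR(ay),\qquad y^{ -1}=1-t\tilde R(xa).$$
   Context: A Rota–Baxter algebra of weight $1$ is an algebra $A$ with a linear map $R$ satisfying $R(a)R(b)=R(R(a)b+aR(b))+R(ab)$ for all $a,b\in A$. -}

module Defs where

open import Level using (Level; _⊔_; suc)
open import Data.Nat as ℕ using (ℕ; zero) renaming (suc to 1+)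
open import Data.Nat using (_∸_)
open import Data.Product using (Σ; _×_)
open import Relation.Nullary using (¬_)
open import Algebra.Bundles using (CommutativeRing; Ring)
open import Algebra.Morphism.Structures using (module RingMorphisms)

module _ {k ℓk : Level} (K : CommutativeRing k ℓk) where
  open CommutativeRing K

  natK : ℕ → Carrier
  natK zero   = 0#
  natK (1+ n) = 1# + natK n

  record IsField : Set (k ⊔ ℓk) where
    field
      0≉1     : ¬ (0# ≈ 1#)
      inverse : ∀ x → ¬ (x ≈ 0#) → Σ Carrier (λ y → x * y ≈ 1#)

  CharZero : Set ℓk
  CharZero = ∀ n → ¬ (natK (1+ n) ≈ 0#)

-- Associative unital K-algebras: a ring A with a ring homomorphism
-- ι : K → A landing in the centre of A (scalar action c·x := ι c * x).

record UnitalAlgebra {k ℓk : Level} (K : CommutativeRing k ℓk) (a ℓa : Level)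
       : Set (k ⊔ ℓk ⊔ suc (a ⊔ ℓa)) where
  field
    ring : Ring a ℓa
  open Ring ring public
  field
    ι       : CommutativeRing.Carrier K → Carrier
    ι-hom   : RingMorphisms.IsRingHomomorphism
                (CommutativeRing.rawRing K) (Ring.rawRing ring) ι
    ι-central : ∀ c x → ι c * x ≈ x * ι c

module _ {k ℓk a ℓa : Level} {K : CommutativeRing k ℓk}
         (A : UnitalAlgebra K a ℓa) where
  open UnitalAlgebra A

  record IsRotaBaxter₁ (R : Carrier → Carrier) : Set (k ⊔ a ⊔ ℓa) where
    field
      R-cong   : ∀ {x y} → x ≈ y → R x ≈ R y
      R-+      : ∀ x y → R (x + y) ≈ R x + R y
      R-scalar : ∀ c x → R (ι c * x) ≈ ι c * R x
      R-RB     : ∀ x y → R x * R y ≈ R (R x * y + x * R y) + R (x * y)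

  tilde : (Carrier → Carrier) → Carrier → Carrier
  tilde R x = - x - R x

  Series : Set a
  Series = ℕ → Carrier

  infix 4 _≈ₛ_
  _≈ₛ_ : Series → Series → Set ℓa
  f ≈ₛ g = ∀ n → f n ≈ g n

  sumBelow : ℕ → (ℕ → Carrier) → Carrier
  sumBelow zero   h = 0#
  sumBelow (1+ n) h = sumBelow n h + h n

  oneₛ : Series
  oneₛ zero   = 1#
  oneₛ (1+ n) = 0#

  constₛ : Carrier → Series
  constₛ c zero   = c
  constₛ c (1+ n) = 0#

  infixl 6 _+ₛ_ _-ₛ_
  infixl 7 _*ₛ_

  _+ₛ_ : Series → Series → Series
  (f +ₛ g) n = f n + g n

  _-ₛ_ : Series → Series → Series
  (f -ₛ g) n = f n - g n

  _*ₛ_ : Series → Series → Series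
  (f *ₛ g) n = sumBelow (1+ n) (λ i → f i * g (n ∸ i))

  tₛ : Series → Series
  tₛ f zero   = 0#
  tₛ f (1+ n) = f n

  extₛ : (Carrier → Carrier) → Series → Series
  extₛ R f n = R (f n)

  IsInverseₛ : Series → Series → Set ℓa
  IsInverseₛ u v = (u *ₛ v ≈ₛ oneₛ) × (v *ₛ u ≈ₛ oneₛ)

-- Put P = x a, Q = a y and Z = x a y. Expanding x y with the two defining equations and the mixed
-- identity R(u) R̃(v) = R(u R̃(v)) + R̃(R(u) v), a consequence of the Rota–Baxter identity, gives
-- x y = 1 + t (R Z + R̃ Z) = 1 - t Z, because R + R̃ = -id. Hence x (y + t Q) = 1 = (x + t P) y, and
-- again by R + R̃ = -id, y + t Q = 1 - t R(Q) and x + t P = 1 - t R̃(P). These one-sided inverses are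
-- two-sided since a power series with constant term 1 is cancellable on both sides.
module Submission where

open import Defs
open import Level using (Level; _⊔_)
open import Data.Nat using (ℕ; zero; _∸_; _<_; z<s; s≤s⁻¹) renaming (suc to 1+)
open import Data.Nat.Properties using (n∸n≡0; +-∸-assoc; ∸-monoʳ-<; m<n⇒m<1+n; n<1+n)
open import Data.Nat.Induction using (<-rec)
open import Data.Product using (_×_; _,_)
open import Algebra.Bundles using (CommutativeRing; Ring; Monoid)
import Algebra.Construct.Pointwise as Pointwise
import Algebra.Properties.Ring as RingProperties
import Algebra.Properties.Group as GroupProperties
import Algebra.Properties.CommutativeSemigroup as CommutativeSemigroupProperties
import Algebra.Solver.CommutativeMonoid as CommutativeMonoidSolver
open import Relation.Binary.PropositionalEquality using (cong)
import Relation.Binary.Reasoning.Setoid as SetoidReasoning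

module _ {m ℓ} (M : Monoid m ℓ) where
  open Monoid M
  open SetoidReasoning setoid

  LeftCancellable : Carrier → Set (m ⊔ ℓ)
  LeftCancellable x = ∀ a b → x ∙ a ≈ x ∙ b → a ≈ b

  RightCancellable : Carrier → Set (m ⊔ ℓ)
  RightCancellable x = ∀ a b → a ∙ x ≈ b ∙ x → a ≈ b

  ≈ε⇒leftCancellable : ∀ {x} → x ≈ ε → LeftCancellable x
  ≈ε⇒leftCancellable {x} x≈ε a b xa≈xb = begin
    a      ≈⟨ identityˡ a ⟨
    ε ∙ a  ≈⟨ ∙-congʳ x≈ε ⟨
    x ∙ a  ≈⟨ xa≈xb ⟩
    x ∙ b  ≈⟨ ∙-congʳ x≈ε ⟩
    ε ∙ b  ≈⟨ identityˡ b ⟩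
    b      ∎

  ≈ε⇒rightCancellable : ∀ {x} → x ≈ ε → RightCancellable x
  ≈ε⇒rightCancellable {x} x≈ε a b ax≈bx = begin
    a      ≈⟨ identityʳ a ⟨
    a ∙ ε  ≈⟨ ∙-congˡ x≈ε ⟨
    a ∙ x  ≈⟨ ax≈bx ⟩
    b ∙ x  ≈⟨ ∙-congˡ x≈ε ⟩
    b ∙ ε  ≈⟨ identityʳ b ⟩
    b      ∎

  inverseʳ⇒inverseˡ : ∀ {x u} → LeftCancellable x → x ∙ u ≈ ε → u ∙ x ≈ ε
  inverseʳ⇒inverseˡ {x} {u} cancel xu≈ε = cancel (u ∙ x) ε (begin
    x ∙ (u ∙ x)  ≈⟨ assoc x u x ⟨
    (x ∙ u) ∙ x  ≈⟨ ∙-congʳ xu≈ε ⟩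
    ε ∙ x        ≈⟨ identityˡ x ⟩
    x            ≈⟨ identityʳ x ⟨
    x ∙ ε        ∎)

  inverseˡ⇒inverseʳ : ∀ {y w} → RightCancellable y → w ∙ y ≈ ε → y ∙ w ≈ ε
  inverseˡ⇒inverseʳ {y} {w} cancel wy≈ε = cancel (y ∙ w) ε (begin
    (y ∙ w) ∙ y  ≈⟨ assoc y w y ⟩
    y ∙ (w ∙ y)  ≈⟨ ∙-congˡ wy≈ε ⟩
    y ∙ ε        ≈⟨ identityʳ y ⟩
    y            ≈⟨ identityˡ y ⟨
    ε ∙ y        ∎)

module _ {r ℓ} (Rg : Ring r ℓ) where
  open Ring Rg

  record IsAdditiveRotaBaxter₁ (R : Carrier → Carrier) : Set (r ⊔ ℓ) where
    field
      R-cong : ∀ {x y} → x ≈ y → R x ≈ R y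
      R-+    : ∀ x y → R (x + y) ≈ R x + R y
      R-RB   : ∀ x y → R x * R y ≈ R (R x * y + x * R y) + R (x * y)

module AdditiveRotaBaxter₁Properties {r ℓ} {Rg : Ring r ℓ} {R : Ring.Carrier Rg → Ring.Carrier Rg}
         (isRB : IsAdditiveRotaBaxter₁ Rg R) where
  open Ring Rg
  open IsAdditiveRotaBaxter₁ isRB public
  open RingProperties Rg
  open CommutativeSemigroupProperties +-commutativeSemigroup using (interchange)
  open SetoidReasoning setoid
  open CommutativeMonoidSolver +-commutativeMonoid using (solve; _⊜_; _⊕_)

  R̃ : Carrier → Carrier
  R̃ x = - x - R x

  R-0 : R 0# ≈ 0#
  R-0 = x+x≈x⇒x≈0 (R 0#) (trans (sym (R-+ 0# 0#)) (R-cong (+-identityˡ 0#)))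

  R-neg : ∀ x → R (- x) ≈ - R x
  R-neg x = +-inverseˡ-unique (R (- x)) (R x)
    (trans (sym (R-+ (- x) x)) (trans (R-cong (-‿inverseˡ x)) R-0))

  R̃-cong : ∀ {x y} → x ≈ y → R̃ x ≈ R̃ y
  R̃-cong x≈y = +-cong (-‿cong x≈y) (-‿cong (R-cong x≈y))

  R̃-+ : ∀ x y → R̃ (x + y) ≈ R̃ x + R̃ y
  R̃-+ x y = begin
    - (x + y) - R (x + y)          ≈⟨ +-cong (sym (-‿+-comm x y)) (-‿cong (R-+ x y)) ⟩
    (- x + - y) - (R x + R y)      ≈⟨ +-congˡ (sym (-‿+-comm (R x) (R y))) ⟩
    (- x + - y) + (- R x + - R y)  ≈⟨ interchange (- x) (- y) (- R x) (- R y) ⟩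
    R̃ x + R̃ y                      ∎

  R̃-0 : R̃ 0# ≈ 0#
  R̃-0 = trans (+-cong -0#≈0# (trans (-‿cong R-0) -0#≈0#)) (+-identityˡ 0#)

  Rx+R̃x≈-x : ∀ x → R x + R̃ x ≈ - x
  Rx+R̃x≈-x x = begin
    R x + (- x - R x)     ≈⟨ solve 3 (λ a b c → a ⊕ (b ⊕ c) ⊜ (a ⊕ c) ⊕ b) refl (R x) (- x) (- R x) ⟩
    (R x - R x) + - x     ≈⟨ +-congʳ (-‿inverseʳ (R x)) ⟩
    0# + - x              ≈⟨ +-identityˡ (- x) ⟩
    - x                   ∎

  R̃x+x≈-Rx : ∀ x → R̃ x + x ≈ - R x
  R̃x+x≈-Rx x = begin
    (- x - R x) + x       ≈⟨ solve 3 (λ a b c → (a ⊕ b) ⊕ c ⊜ (a ⊕ c) ⊕ b) refl (- x) (- R x) x ⟩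
    (- x + x) - R x       ≈⟨ +-congʳ (-‿inverseˡ x) ⟩
    0# - R x              ≈⟨ +-identityˡ (- R x) ⟩
    - R x                 ∎

  Rx+x≈-R̃x : ∀ x → R x + x ≈ - R̃ x
  Rx+x≈-R̃x x = begin
    R x + x               ≈⟨ +-comm (R x) x ⟩
    x + R x               ≈⟨ +-cong (-‿involutive x) (-‿involutive (R x)) ⟨
    - - x + - - R x       ≈⟨ -‿+-comm (- x) (- R x) ⟩
    - (- x - R x)         ∎

  Rx*R̃y≈R[x*R̃y]+R̃[Rx*y] : ∀ x y → R x * R̃ y ≈ R (x * R̃ y) + R̃ (R x * y)
  Rx*R̃y≈R[x*R̃y]+R̃[Rx*y] x y = begin
    R x * (- y - R y)
      ≈⟨ x[y-z]≈xy-xz (R x) (- y) (R y) ⟩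
    R x * - y - R x * R y
      ≈⟨ +-cong (sym (-‿distribʳ-* (R x) y)) (-‿cong (trans (R-RB x y) (+-congʳ (R-+ _ _)))) ⟩
    - α - ((β + γ) + δ)
      ≈⟨ +-congˡ (trans (sym (-‿+-comm _ _)) (+-congʳ (sym (-‿+-comm _ _)))) ⟩
    - α + ((- β + - γ) + - δ)
      ≈⟨ solve 4 (λ a b c d → a ⊕ ((b ⊕ c) ⊕ d) ⊜ (d ⊕ c) ⊕ (a ⊕ b)) refl (- α) (- β) (- γ) (- δ) ⟩
    (- δ + - γ) + (- α + - β)
      ≈⟨ +-congʳ (trans (R-+ _ _) (+-cong (R-neg _) (R-neg _))) ⟨
    R (- (x * y) - x * R y) + R̃ (R x * y)
      ≈⟨ +-congʳ (R-cong (trans (x[y-z]≈xy-xz x (- y) (R y)) (+-congʳ (sym (-‿distribʳ-* x y))))) ⟨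
    R (x * R̃ y) + R̃ (R x * y)
      ∎
    where
    α β γ δ : Carrier
    α = R x * y
    β = R (R x * y)
    γ = R (x * R y)
    δ = R (x * y)

isRotaBaxter₁⇒isAdditiveRotaBaxter₁ : ∀ {k ℓk a ℓa} {K : CommutativeRing k ℓk}
  {A : UnitalAlgebra K a ℓa} {R : UnitalAlgebra.Carrier A → UnitalAlgebra.Carrier A} →
  IsRotaBaxter₁ A R → IsAdditiveRotaBaxter₁ (UnitalAlgebra.ring A) R
isRotaBaxter₁⇒isAdditiveRotaBaxter₁ isRB = record { R-cong = R-cong ; R-+ = R-+ ; R-RB = R-RB }
  where open IsRotaBaxter₁ isRB

module PowerSeries {k ℓk a ℓa} {K : CommutativeRing k ℓk} (A : UnitalAlgebra K a ℓa) where
  open UnitalAlgebra A hiding (zero)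
  open RingProperties ring using (+-cancelˡ; +-cancelʳ; -0#≈0#)
  open CommutativeSemigroupProperties +-commutativeSemigroup using (interchange)
  open SetoidReasoning setoid

  sum : ℕ → (ℕ → Carrier) → Carrier
  sum = sumBelow A

  sum-cong< : ∀ n {f g : ℕ → Carrier} → (∀ i → i < n → f i ≈ g i) → sum n f ≈ sum n g
  sum-cong< zero   f≈g = refl
  sum-cong< (1+ n) f≈g = +-cong (sum-cong< n (λ i i<n → f≈g i (m<n⇒m<1+n i<n))) (f≈g n (n<1+n n))

  sum-cong : ∀ n {f g : ℕ → Carrier} → (∀ i → f i ≈ g i) → sum n f ≈ sum n g
  sum-cong n f≈g = sum-cong< n (λ i _ → f≈g i)

  sum-0 : ∀ n → sum n (λ _ → 0#) ≈ 0#
  sum-0 zero   = refl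
  sum-0 (1+ n) = trans (+-identityʳ _) (sum-0 n)

  sum-distrib-+ : ∀ n (f g : ℕ → Carrier) → sum n (λ i → f i + g i) ≈ sum n f + sum n g
  sum-distrib-+ zero   f g = sym (+-identityˡ 0#)
  sum-distrib-+ (1+ n) f g = trans (+-congʳ (sum-distrib-+ n f g)) (interchange _ _ _ _)

  *-distribʳ-sum : ∀ n c (f : ℕ → Carrier) → sum n f * c ≈ sum n (λ i → f i * c)
  *-distribʳ-sum zero   c f = zeroˡ c
  *-distribʳ-sum (1+ n) c f = trans (distribʳ c _ _) (+-congʳ (*-distribʳ-sum n c f))

  sum-suc : ∀ n (f : ℕ → Carrier) → sum (1+ n) f ≈ f 0 + sum n (λ i → f (1+ i))
  sum-suc zero   f = trans (+-identityˡ _) (sym (+-identityʳ _))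
  sum-suc (1+ n) f = trans (+-congʳ (sum-suc n f)) (+-assoc _ _ _)

  sum-homo : (φ : Carrier → Carrier) → (∀ x y → φ (x + y) ≈ φ x + φ y) → φ 0# ≈ 0# →
             ∀ n (f : ℕ → Carrier) → φ (sum n f) ≈ sum n (λ i → φ (f i))
  sum-homo φ φ-+ φ-0 zero   f = φ-0
  sum-homo φ φ-+ φ-0 (1+ n) f = trans (φ-+ _ _) (+-congʳ (sum-homo φ φ-+ φ-0 n f))

  infix  4 _≋_
  infixl 6 _⊕_
  infixl 7 _⊛_
  infixr 8 t·_

  _≋_ : Series A → Series A → Set ℓa
  _≋_ = _≈ₛ_ A

  _⊕_ : Series A → Series A → Series A
  _⊕_ = _+ₛ_ A

  _⊛_ : Series A → Series A → Series A
  _⊛_ = _*ₛ_ A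

  𝟙 : Series A
  𝟙 = oneₛ A

  t·_ : Series A → Series A
  t·_ = tₛ A

  shiftₛ : Series A → Series A
  shiftₛ f n = f (1+ n)

  ⊛-coeff-0 : ∀ f g → (f ⊛ g) 0 ≈ f 0 * g 0
  ⊛-coeff-0 f g = +-identityˡ _

  ⊛-coeffˡ : ∀ f g n → (f ⊛ g) n ≈ f 0 * g n + sum n (λ i → f (1+ i) * g (n ∸ 1+ i))
  ⊛-coeffˡ f g n = sum-suc n (λ i → f i * g (n ∸ i))

  ⊛-coeffʳ : ∀ f g n → (f ⊛ g) n ≈ sum n (λ i → f i * g (n ∸ i)) + f n * g 0
  ⊛-coeffʳ f g n = +-congˡ (*-congˡ (reflexive (cong g (n∸n≡0 n))))

  ⊛-coeff-suc : ∀ f g n → (f ⊛ g) (1+ n) ≈ (f ⊛ shiftₛ g) n + f (1+ n) * g 0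
  ⊛-coeff-suc f g n = trans (⊛-coeffʳ f g (1+ n))
    (+-congʳ (sum-cong< (1+ n) (λ i i<1+n → *-congˡ (reflexive (cong g (+-∸-assoc 1 (s≤s⁻¹ i<1+n)))))))

  ⊛-*ʳ : ∀ f g c n → (f ⊛ (λ m → g m * c)) n ≈ (f ⊛ g) n * c
  ⊛-*ʳ f g c n = trans (sum-cong (1+ n) (λ i → sym (*-assoc _ _ _))) (sym (*-distribʳ-sum (1+ n) c _))

  ⊛-cong : ∀ {f f′ g g′} → f ≋ f′ → g ≋ g′ → f ⊛ g ≋ f′ ⊛ g′
  ⊛-cong f≋f′ g≋g′ n = sum-cong (1+ n) (λ i → *-cong (f≋f′ i) (g≋g′ (n ∸ i)))

  ⊛-distribˡ : ∀ f g h → f ⊛ (g ⊕ h) ≋ f ⊛ g ⊕ f ⊛ h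
  ⊛-distribˡ f g h n = trans (sum-cong (1+ n) (λ i → distribˡ (f i) _ _)) (sum-distrib-+ (1+ n) _ _)

  ⊛-distribʳ : ∀ h f g → (f ⊕ g) ⊛ h ≋ f ⊛ h ⊕ g ⊛ h
  ⊛-distribʳ h f g n = trans (sum-cong (1+ n) (λ i → distribʳ _ (f i) (g i))) (sum-distrib-+ (1+ n) _ _)

  ⊛-identityˡ : ∀ f → 𝟙 ⊛ f ≋ f
  ⊛-identityˡ f n = begin
    (𝟙 ⊛ f) n                                    ≈⟨ ⊛-coeffˡ 𝟙 f n ⟩
    1# * f n + sum n (λ i → 0# * f (n ∸ 1+ i))
      ≈⟨ +-cong (*-identityˡ (f n)) (trans (sum-cong n (λ i → zeroˡ _)) (sum-0 n)) ⟩
    f n + 0#                                     ≈⟨ +-identityʳ (f n) ⟩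
    f n                                          ∎

  ⊛-identityʳ : ∀ f → f ⊛ 𝟙 ≋ f
  ⊛-identityʳ f n = begin
    (f ⊛ 𝟙) n                                ≈⟨ ⊛-coeffʳ f 𝟙 n ⟩
    sum n (λ i → f i * 𝟙 (n ∸ i)) + f n * 1#
      ≈⟨ +-cong (trans (sum-cong< n 𝟙-vanishes) (sum-0 n)) (*-identityʳ (f n)) ⟩
    0# + f n                                 ≈⟨ +-identityˡ (f n) ⟩
    f n                                      ∎
    where
    𝟙-vanishes : ∀ i → i < n → f i * 𝟙 (n ∸ i) ≈ 0#
    𝟙-vanishes i i<n = trans (*-congˡ (reflexive (cong 𝟙 (+-∸-assoc 1 i<n)))) (zeroʳ (f i))

  -- Induction on the degree with h generalised: splitting off the h 0 terms leaves (f ⊛ g) ⊛ shiftₛ h.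
  ⊛-assoc : ∀ f g h → (f ⊛ g) ⊛ h ≋ f ⊛ (g ⊛ h)
  ⊛-assoc f g h zero = begin
    ((f ⊛ g) ⊛ h) 0    ≈⟨ ⊛-coeff-0 (f ⊛ g) h ⟩
    (f ⊛ g) 0 * h 0    ≈⟨ *-congʳ (⊛-coeff-0 f g) ⟩
    (f 0 * g 0) * h 0  ≈⟨ *-assoc (f 0) (g 0) (h 0) ⟩
    f 0 * (g 0 * h 0)  ≈⟨ *-congˡ (⊛-coeff-0 g h) ⟨
    f 0 * (g ⊛ h) 0    ≈⟨ ⊛-coeff-0 f (g ⊛ h) ⟨
    (f ⊛ (g ⊛ h)) 0    ∎
  ⊛-assoc f g h (1+ n) = begin
    ((f ⊛ g) ⊛ h) (1+ n)
      ≈⟨ ⊛-coeff-suc (f ⊛ g) h n ⟩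
    ((f ⊛ g) ⊛ shiftₛ h) n + (f ⊛ g) (1+ n) * h 0
      ≈⟨ +-cong (⊛-assoc f g (shiftₛ h) n) (*-congʳ (⊛-coeff-suc f g n)) ⟩
    (f ⊛ (g ⊛ shiftₛ h)) n + ((f ⊛ shiftₛ g) n + f (1+ n) * g 0) * h 0
      ≈⟨ +-congˡ (trans (distribʳ _ _ _) (+-cong (sym (⊛-*ʳ f (shiftₛ g) (h 0) n)) (*-assoc _ _ _))) ⟩
    (f ⊛ (g ⊛ shiftₛ h)) n + ((f ⊛ g′h₀) n + f (1+ n) * (g 0 * h 0))
      ≈⟨ +-assoc _ _ _ ⟨
    ((f ⊛ (g ⊛ shiftₛ h)) n + (f ⊛ g′h₀) n) + f (1+ n) * (g 0 * h 0)
      ≈⟨ +-cong (sym (⊛-distribˡ f (g ⊛ shiftₛ h) g′h₀ n)) (*-congˡ (sym (⊛-coeff-0 g h))) ⟩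
    (f ⊛ (g ⊛ shiftₛ h ⊕ g′h₀)) n + f (1+ n) * (g ⊛ h) 0
      ≈⟨ +-congʳ (⊛-cong {f} (λ _ → refl) (λ m → sym (⊛-coeff-suc g h m)) n) ⟩
    (f ⊛ shiftₛ (g ⊛ h)) n + f (1+ n) * (g ⊛ h) 0
      ≈⟨ ⊛-coeff-suc f (g ⊛ h) n ⟨
    (f ⊛ (g ⊛ h)) (1+ n)
      ∎
    where
    g′h₀ : Series A
    g′h₀ m = g (1+ m) * h 0

  seriesRing : Ring a ℓa
  seriesRing = record
    { Carrier = Series A
    ; _≈_     = _≋_
    ; _+_     = _⊕_
    ; _*_     = _⊛_
    ; -_      = λ f n → - f n
    ; 0#      = λ _ → 0#
    ; 1#      = 𝟙
    ; isRing  = record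
      { +-isAbelianGroup = Pointwise.isAbelianGroup ℕ +-isAbelianGroup
      ; *-cong           = ⊛-cong
      ; *-assoc          = ⊛-assoc
      ; *-identity       = ⊛-identityˡ , ⊛-identityʳ
      ; distrib          = ⊛-distribˡ , ⊛-distribʳ
      }
    }

  ⊛-cancelˡ : ∀ {f} → LeftCancellable *-monoid (f 0) → ∀ d d′ → f ⊛ d ≋ f ⊛ d′ → d ≋ d′
  ⊛-cancelˡ {f} f₀-cancel d d′ fd≋fd′ = <-rec _ step
    where
    step : ∀ n → (∀ {m} → m < n → d m ≈ d′ m) → d n ≈ d′ n
    step n ih = f₀-cancel (d n) (d′ n) (+-cancelʳ (sum n (λ i → f (1+ i) * d (n ∸ 1+ i))) _ _ (begin
      f 0 * d n + sum n (λ i → f (1+ i) * d (n ∸ 1+ i))    ≈⟨ ⊛-coeffˡ f d n ⟨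
      (f ⊛ d) n                                            ≈⟨ fd≋fd′ n ⟩
      (f ⊛ d′) n                                           ≈⟨ ⊛-coeffˡ f d′ n ⟩
      f 0 * d′ n + sum n (λ i → f (1+ i) * d′ (n ∸ 1+ i))
        ≈⟨ +-congˡ (sum-cong< n (λ i i<n → *-congˡ (sym (ih (∸-monoʳ-< z<s i<n))))) ⟩
      f 0 * d′ n + sum n (λ i → f (1+ i) * d (n ∸ 1+ i))   ∎))

  ⊛-cancelʳ : ∀ {f} → RightCancellable *-monoid (f 0) → ∀ d d′ → d ⊛ f ≋ d′ ⊛ f → d ≋ d′
  ⊛-cancelʳ {f} f₀-cancel d d′ df≋d′f = <-rec _ step
    where
    step : ∀ n → (∀ {m} → m < n → d m ≈ d′ m) → d n ≈ d′ n
    step n ih = f₀-cancel (d n) (d′ n) (+-cancelˡ (sum n (λ i → d i * f (n ∸ i))) _ _ (begin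
      sum n (λ i → d i * f (n ∸ i)) + d n * f 0    ≈⟨ ⊛-coeffʳ d f n ⟨
      (d ⊛ f) n                                    ≈⟨ df≋d′f n ⟩
      (d′ ⊛ f) n                                   ≈⟨ ⊛-coeffʳ d′ f n ⟩
      sum n (λ i → d′ i * f (n ∸ i)) + d′ n * f 0  ≈⟨ +-congʳ (sum-cong< n (λ i i<n → *-congʳ (sym (ih i<n)))) ⟩
      sum n (λ i → d i * f (n ∸ i)) + d′ n * f 0   ∎))

  t·-cong : ∀ {f g} → f ≋ g → t· f ≋ t· g
  t·-cong f≋g zero   = refl
  t·-cong f≋g (1+ n) = f≋g n

  t·-+ : ∀ f g → t· (f ⊕ g) ≋ t· f ⊕ t· g
  t·-+ f g zero   = sym (+-identityʳ 0#)
  t·-+ f g (1+ n) = refl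

  t·-neg : ∀ f → t· (λ n → - f n) ≋ (λ n → - (t· f) n)
  t·-neg f zero   = sym (-0#≈0#)
  t·-neg f (1+ n) = refl

  t·-*ˡ : ∀ f g → t· f ⊛ g ≋ t· (f ⊛ g)
  t·-*ˡ f g zero   = trans (⊛-coeff-0 (t· f) g) (zeroˡ (g 0))
  t·-*ˡ f g (1+ n) = trans (⊛-coeffˡ (t· f) g (1+ n)) (trans (+-congʳ (zeroˡ _)) (+-identityˡ _))

  t·-*ʳ : ∀ f g → f ⊛ t· g ≋ t· (f ⊛ g)
  t·-*ʳ f g zero   = trans (⊛-coeff-0 f (t· g)) (zeroʳ (f 0))
  t·-*ʳ f g (1+ n) = trans (⊛-coeff-suc f (t· g) n) (trans (+-congˡ (zeroʳ _)) (+-identityʳ _))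

  extₛ-t· : ∀ {φ} → φ 0# ≈ 0# → ∀ f → extₛ A φ (t· f) ≋ t· extₛ A φ f
  extₛ-t· φ-0 f zero   = φ-0
  extₛ-t· φ-0 f (1+ n) = refl

  extₛ-isAdditiveRotaBaxter₁ : ∀ {R} → IsAdditiveRotaBaxter₁ ring R →
                               IsAdditiveRotaBaxter₁ seriesRing (extₛ A R)
  extₛ-isAdditiveRotaBaxter₁ {R} isRB = record
    { R-cong = λ f≋g n → R-cong (f≋g n)
    ; R-+    = λ f g n → R-+ (f n) (g n)
    ; R-RB   = R̂-RB
    }
    where
    open AdditiveRotaBaxter₁Properties isRB using (R-cong; R-+; R-RB; R-0)
    R̂ : Series A → Series A
    R̂ = extₛ A R
    R̂-RB : ∀ f g → R̂ f ⊛ R̂ g ≋ R̂ (R̂ f ⊛ g ⊕ f ⊛ R̂ g) ⊕ R̂ (f ⊛ g)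
    R̂-RB f g n = begin
      sum (1+ n) (λ i → R (f i) * R (g (n ∸ i)))
        ≈⟨ sum-cong (1+ n) (λ i → R-RB (f i) (g (n ∸ i))) ⟩
      sum (1+ n) (λ i → R (R (f i) * g (n ∸ i) + f i * R (g (n ∸ i))) + R (f i * g (n ∸ i)))
        ≈⟨ sum-distrib-+ (1+ n) _ _ ⟩
      sum (1+ n) (λ i → R (R (f i) * g (n ∸ i) + f i * R (g (n ∸ i)))) + sum (1+ n) (λ i → R (f i * g (n ∸ i)))
        ≈⟨ +-cong (sum-homo R R-+ R-0 (1+ n) _) (sum-homo R R-+ R-0 (1+ n) _) ⟨
      R (sum (1+ n) (λ i → R (f i) * g (n ∸ i) + f i * R (g (n ∸ i)))) + R ((f ⊛ g) n)
        ≈⟨ +-congʳ (R-cong (sum-distrib-+ (1+ n) _ _)) ⟩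
      R ((R̂ f ⊛ g) n + (f ⊛ R̂ g) n) + R ((f ⊛ g) n)
        ∎

module SeriesRingProperties {k ℓk a ℓa} {K : CommutativeRing k ℓk} (A : UnitalAlgebra K a ℓa) where
  open PowerSeries A using (seriesRing; t·_; t·-cong; t·-+; t·-neg; t·-*ˡ; t·-*ʳ)
  open Ring seriesRing
  open SetoidReasoning setoid

  [1+tg]f≈f+t[gf] : ∀ g f → (1# + t· g) * f ≈ f + t· (g * f)
  [1+tg]f≈f+t[gf] g f = trans (distribʳ f 1# (t· g)) (+-cong (*-identityˡ f) (t·-*ˡ g f))

  f[1+tg]≈f+t[fg] : ∀ f g → f * (1# + t· g) ≈ f + t· (f * g)
  f[1+tg]≈f+t[fg] f g = trans (distribˡ f 1# (t· g)) (+-cong (*-identityʳ f) (t·-*ʳ f g))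

  [1+tg]+th≈1-tf : ∀ {f g h} → g + h ≈ - f → (1# + t· g) + t· h ≈ 1# - t· f
  [1+tg]+th≈1-tf {f} {g} {h} g+h≈-f = begin
    (1# + t· g) + t· h  ≈⟨ +-assoc 1# (t· g) (t· h) ⟩
    1# + (t· g + t· h)  ≈⟨ +-congˡ (t·-+ g h) ⟨
    1# + t· (g + h)     ≈⟨ +-congˡ (t·-cong g+h≈-f) ⟩
    1# + t· (- f)       ≈⟨ +-congˡ (t·-neg f) ⟩
    1# - t· f           ∎

module InverseFormulas {k ℓk a ℓa} {K : CommutativeRing k ℓk} (A : UnitalAlgebra K a ℓa)
         {R : UnitalAlgebra.Carrier A → UnitalAlgebra.Carrier A} (isRB : IsRotaBaxter₁ A R)
         (c : UnitalAlgebra.Carrier A) where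
  open PowerSeries A using (seriesRing; t·_; t·-cong; t·-+; t·-*ʳ; t·-*ˡ; extₛ-t·;
                            extₛ-isAdditiveRotaBaxter₁; ⊛-cancelˡ; ⊛-cancelʳ)
  open SeriesRingProperties A
  open Ring seriesRing
  open GroupProperties +-group using (//-rightDividesˡ)
  open SetoidReasoning setoid
  open CommutativeMonoidSolver +-commutativeMonoid using (solve; _⊜_; _⊕_)
  private
    module Aᴿ = UnitalAlgebra A
    isAdditiveRB : IsAdditiveRotaBaxter₁ Aᴿ.ring R
    isAdditiveRB = isRotaBaxter₁⇒isAdditiveRotaBaxter₁ isRB
    module Rᴬ = AdditiveRotaBaxter₁Properties isAdditiveRB
  open AdditiveRotaBaxter₁Properties (extₛ-isAdditiveRotaBaxter₁ isAdditiveRB)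
    using (R-cong; R-+; R̃; R̃-cong; R̃-+; Rx*R̃y≈R[x*R̃y]+R̃[Rx*y]; Rx+R̃x≈-x; R̃x+x≈-Rx; Rx+x≈-R̃x)

  ℛ : Series A → Series A
  ℛ = extₛ A R

  ĉ : Series A
  ĉ = constₛ A c

  t·-ℛ+R̃ : ∀ f g → t· (ℛ f + R̃ g) ≈ ℛ (t· f) + R̃ (t· g)
  t·-ℛ+R̃ f g = trans (t·-+ (ℛ f) (R̃ g))
    (sym (+-cong (extₛ-t· {R} Rᴬ.R-0 f) (extₛ-t· {Rᴬ.R̃} Rᴬ.R̃-0 g)))

  -- R̃ on series unfolds to extₛ A (tilde A R), so x-eq and y-eq are the equations of the theorem.
  module Solutions {x y : Series A} (x-eq : x ≈ 1# + t· ℛ (x * ĉ)) (y-eq : y ≈ 1# + t· R̃ (ĉ * y)) where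
    P Q Z : Series A
    P = x * ĉ
    Q = ĉ * y
    Z = P * y

    P*y≈P+t[P*R̃Q] : P * y ≈ P + t· (P * R̃ Q)
    P*y≈P+t[P*R̃Q] = trans (*-congˡ {P} y-eq) (f[1+tg]≈f+t[fg] P (R̃ Q))

    x*Q≈Q+t[ℛP*Q] : x * Q ≈ Q + t· (ℛ P * Q)
    x*Q≈Q+t[ℛP*Q] = trans (*-congʳ {Q} x-eq) ([1+tg]f≈f+t[gf] (ℛ P) Q)

    x*Q≈Z : x * Q ≈ Z
    x*Q≈Z = sym (*-assoc x ĉ y)

    R̃Q+ℛP*y≈ℛZ+R̃Z : R̃ Q + ℛ P * y ≈ ℛ Z + R̃ Z
    R̃Q+ℛP*y≈ℛZ+R̃Z = begin
      R̃ Q + ℛ P * y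
        ≈⟨ +-congˡ (trans (*-congˡ {ℛ P} y-eq) (f[1+tg]≈f+t[fg] (ℛ P) (R̃ Q))) ⟩
      R̃ Q + (ℛ P + t· (ℛ P * R̃ Q))
        ≈⟨ +-congˡ (+-congˡ (t·-cong (Rx*R̃y≈R[x*R̃y]+R̃[Rx*y] P Q))) ⟩
      R̃ Q + (ℛ P + t· (ℛ (P * R̃ Q) + R̃ (ℛ P * Q)))
        ≈⟨ +-congˡ (+-congˡ (t·-ℛ+R̃ (P * R̃ Q) (ℛ P * Q))) ⟩
      R̃ Q + (ℛ P + (ℛ (t· (P * R̃ Q)) + R̃ (t· (ℛ P * Q))))
        ≈⟨ solve 4 (λ a b c d → a ⊕ (b ⊕ (c ⊕ d)) ⊜ (b ⊕ c) ⊕ (a ⊕ d)) refl _ _ _ _ ⟩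
      (ℛ P + ℛ (t· (P * R̃ Q))) + (R̃ Q + R̃ (t· (ℛ P * Q)))
        ≈⟨ +-cong (R-+ P _) (R̃-+ Q _) ⟨
      ℛ (P + t· (P * R̃ Q)) + R̃ (Q + t· (ℛ P * Q))
        ≈⟨ +-cong (R-cong P*y≈P+t[P*R̃Q]) (R̃-cong (trans (sym x*Q≈Z) x*Q≈Q+t[ℛP*Q])) ⟨
      ℛ Z + R̃ Z
        ∎

    x*y≈1-tZ : x * y ≈ 1# - t· Z
    x*y≈1-tZ = begin
      x * y                         ≈⟨ trans (*-congʳ {y} x-eq) ([1+tg]f≈f+t[gf] (ℛ P) y) ⟩
      y + t· (ℛ P * y)              ≈⟨ +-congʳ {t· (ℛ P * y)} y-eq ⟩
      (1# + t· R̃ Q) + t· (ℛ P * y)  ≈⟨ [1+tg]+th≈1-tf (trans R̃Q+ℛP*y≈ℛZ+R̃Z (Rx+R̃x≈-x Z)) ⟩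
      1# - t· Z                     ∎

    x*[1-tℛQ]≈1 : x * (1# - t· ℛ Q) ≈ 1#
    x*[1-tℛQ]≈1 = begin
      x * (1# - t· ℛ Q)   ≈⟨ *-congˡ {x} (trans (+-congʳ {t· Q} y-eq) ([1+tg]+th≈1-tf (R̃x+x≈-Rx Q))) ⟨
      x * (y + t· Q)      ≈⟨ distribˡ x y (t· Q) ⟩
      x * y + x * t· Q    ≈⟨ +-cong x*y≈1-tZ (trans (t·-*ʳ x Q) (t·-cong x*Q≈Z)) ⟩
      (1# - t· Z) + t· Z  ≈⟨ //-rightDividesˡ (t· Z) 1# ⟩
      1#                  ∎

    [1-tR̃P]*y≈1 : (1# - t· R̃ P) * y ≈ 1#
    [1-tR̃P]*y≈1 = begin
      (1# - t· R̃ P) * y   ≈⟨ *-congʳ {y} (trans (+-congʳ {t· P} x-eq) ([1+tg]+th≈1-tf (Rx+x≈-R̃x P))) ⟨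
      (x + t· P) * y      ≈⟨ distribʳ y x (t· P) ⟩
      x * y + t· P * y    ≈⟨ +-cong x*y≈1-tZ (t·-*ˡ P y) ⟩
      (1# - t· Z) + t· Z  ≈⟨ //-rightDividesˡ (t· Z) 1# ⟩
      1#                  ∎

    x-leftCancellable : LeftCancellable *-monoid x
    x-leftCancellable = ⊛-cancelˡ {x} (≈ε⇒leftCancellable Aᴿ.*-monoid x₀≈1)
      where
      x₀≈1 : x 0 Aᴿ.≈ Aᴿ.1#
      x₀≈1 = Aᴿ.trans (x-eq 0) (Aᴿ.+-identityʳ Aᴿ.1#)

    y-rightCancellable : RightCancellable *-monoid y
    y-rightCancellable = ⊛-cancelʳ {y} (≈ε⇒rightCancellable Aᴿ.*-monoid y₀≈1)
      where
      y₀≈1 : y 0 Aᴿ.≈ Aᴿ.1#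
      y₀≈1 = Aᴿ.trans (y-eq 0) (Aᴿ.+-identityʳ Aᴿ.1#)

mainTheorem5 : {k ℓk a ℓa : Level} (K : CommutativeRing k ℓk)
    → IsField K → CharZero K
    → (A : UnitalAlgebra K a ℓa)
    → (R : UnitalAlgebra.Carrier A → UnitalAlgebra.Carrier A)
    → IsRotaBaxter₁ A R
    → (c : UnitalAlgebra.Carrier A) (x y : Series A)
    → _≈ₛ_ A x (_+ₛ_ A (oneₛ A) (tₛ A (extₛ A R (_*ₛ_ A x (constₛ A c)))))
    → _≈ₛ_ A y (_+ₛ_ A (oneₛ A) (tₛ A (extₛ A (tilde A R) (_*ₛ_ A (constₛ A c) y))))
    → IsInverseₛ A x (_-ₛ_ A (oneₛ A) (tₛ A (extₛ A R (_*ₛ_ A (constₛ A c) y))))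
    × IsInverseₛ A y (_-ₛ_ A (oneₛ A) (tₛ A (extₛ A (tilde A R) (_*ₛ_ A x (constₛ A c)))))
mainTheorem5 K _ _ A R isRB c x y x-eq y-eq =
    (x*[1-tℛQ]≈1 , inverseʳ⇒inverseˡ *-monoid x-leftCancellable x*[1-tℛQ]≈1)
  , (inverseˡ⇒inverseʳ *-monoid y-rightCancellable [1-tR̃P]*y≈1 , [1-tR̃P]*y≈1)
  where
  open InverseFormulas.Solutions A isRB c x-eq y-eq
  open Ring (PowerSeries.seriesRing A) using (*-monoid)
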